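{- Let $G$ be a finite connected undirected unweighted graph whose edge set can be covered by $k$ shortest paths. For any vertex $a$ of $G$ and any integer $D$, there are at most $h(k)=\sum_{l=1}^{k}2^l\frac{k!}{(k-l)!}$ vertices at distance exactly $D$ from $a$. -}

module Defs where

open import Data.Nat using (ℕ; zero; suc; _+_; _*_; _^_; _≤_)
open import Data.Nat.Combinatorics using (_P_)
open import Data.Fin using (Fin)
open import Data.List using (List; map; applyUpTo)
open import Data.Nat.ListAction using (sum)
open import Data.Product using (Σ; _×_; ∃)
open import Data.Sum using (_⊎_)
open import Data.Empty using (⊥)
open import Relation.Nullary using (¬_)

record Graph (n : ℕ) : Set₁ where
  field
    Adj     : Fin n → Fin n → Set
    irrefl  : ∀ {u} → ¬ Adj u u
    sym     : ∀ {u v} → Adj u v → Adj v u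
open Graph public

module _ {n : ℕ} (G : Graph n) where

  data Walk : Fin n → Fin n → ℕ → Set where
    [] : ∀ {u} → Walk u u 0
    _∷_ : ∀ {u v w l} → Adj G u v → Walk v w l → Walk u w (suc l)

  IsDist : Fin n → Fin n → ℕ → Set
  IsDist u v D = Walk u v D × (∀ {m} → Walk u v m → D ≤ m)

  Connected : Set
  Connected = ∀ u v → ∃ λ l → Walk u v l

  -- A shortest path: a walk whose length equals the distance between its ends
  -- (such a walk is automatically a path).
  record ShortestPath : Set where
    constructor sp
    field
      src tgt : Fin n
      len     : ℕ
      walk    : Walk src tgt len
      minimal : ∀ {m} → Walk src tgt m → len ≤ m

  data Traverses : ∀ {u v l} → Walk u v l → Fin n → Fin n → Set where
    this : ∀ {u v w l} (e : Adj G u v) (p : Walk v w l) → Traverses (e ∷ p) u v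
    next : ∀ {u v w l x y} (e : Adj G u v) {p : Walk v w l} →
           Traverses p x y → Traverses (e ∷ p) x y

  EdgeOn : ShortestPath → Fin n → Fin n → Set
  EdgeOn P x y = Traverses (ShortestPath.walk P) x y ⊎ Traverses (ShortestPath.walk P) y x

  CoveredBy : (k : ℕ) → (Fin k → ShortestPath) → Set
  CoveredBy k P = ∀ x y → Adj G x y → ∃ λ i → EdgeOn (P i) x y

-- h(k) = Σ_{l=1}^{k} 2^l · k!/(k-l)!   (k P l = k!/(k-l)! is the falling factorial)
h : ℕ → ℕ
h k = sum (map (λ l → 2 ^ l * (k P l)) (applyUpTo suc k))

{-# OPTIONS --safe #-}
-- A vertex v at distance D ≥ 1 from a is reached by a route: a sequence of ascents, each
-- along one of the k shortest paths in one of its two orientations, on which the distance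
-- from a grows by exactly the length travelled, no path being used twice. Routes exist by
-- induction on D: the last edge of a shortest walk to v lies on some path P; if P was used
-- before, the route is cut back to the start of that ascent and continued along P to v.
-- The code of a route, its list of (path, orientation) pairs, determines v: two routes with
-- the same code, of lengths s and s′, end at vertices joined by a walk of length ∣ s - s′ ∣,
-- because along a geodesic the distance from a changes by at most one per step.
-- So the vertices at distance D inject into the codes, and there are h(k) of them.
module Submission where

open import Defs hiding (sym)
open import Data.Nat
  using (ℕ; zero; suc; _+_; _*_; _^_; _∸_; _≤_; _<_; z≤n; s≤s; _<ᵇ_; ∣_-_∣; _≤?_)
open import Data.Nat.Properties
open import Data.Nat.Combinatorics using (_P_)
open import Data.Nat.Combinatorics.Base using (_P′_)
open import Data.Nat.ListAction using (sum)
open import Data.Nat.Tactic.RingSolver using (solve-∀)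
open import Algebra.Properties.CommutativeSemigroup *-commutativeSemigroup using (x∙yz≈y∙xz)
open import Data.Bool using (Bool; true; false)
open import Data.Fin using (Fin) renaming (_≟_ to _≟ᶠ_)
open import Data.List as List using (List; []; _∷_; [_]; length; applyUpTo; allFin)
open import Data.List.Properties
  using (length-map; length-++; length-removeAt′; length-tabulate; map-cong)
open import Data.List.Relation.Unary.Any using (here; there; _─_)
open import Data.List.Relation.Unary.All as All using (All; []; _∷_)
open import Data.List.Relation.Unary.All.Properties using (map⁺; ¬Any⇒All¬)
open import Data.List.Relation.Unary.Unique.Propositional using (Unique)
open import Data.List.Relation.Unary.AllPairs using ([]; _∷_)
open import Data.List.Membership.Propositional using (_∈_; _∉_)
open import Data.List.Membership.Propositional.Properties
  using (∈-map⁺; ∈-++⁺ˡ; ∈-++⁺ʳ; ∈-concat⁺′; ∈-allFin; ∈-applyUpTo⁺)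
open import Data.Product using (∃-syntax; _×_; _,_; -,_; proj₁; proj₂; map₂)
open import Data.Sum using (inj₁; inj₂)
open import Data.Empty using (⊥-elim)
open import Function using (_∘_; id)
open import Relation.Nullary using (yes; no; contradiction)
open import Relation.Binary.PropositionalEquality
  using (_≡_; _≢_; refl; sym; trans; cong; cong₂; subst; subst₂; module ≡-Reasoning)

[1+n]P′[1+k]≡[1+n]*nP′k : ∀ n k → suc n P′ suc k ≡ suc n * (n P′ k)
[1+n]P′[1+k]≡[1+n]*nP′k n zero = refl
[1+n]P′[1+k]≡[1+n]*nP′k n (suc k) = begin
  (n ∸ k) * (suc n P′ suc k)   ≡⟨ cong ((n ∸ k) *_) ([1+n]P′[1+k]≡[1+n]*nP′k n k) ⟩
  (n ∸ k) * (suc n * (n P′ k)) ≡⟨ x∙yz≈y∙xz (n ∸ k) (suc n) (n P′ k) ⟩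
  suc n * ((n ∸ k) * (n P′ k)) ∎
  where open ≡-Reasoning

[1+n]P[1+k]≡[1+n]*nPk : ∀ n k → suc n P suc k ≡ suc n * (n P k)
[1+n]P[1+k]≡[1+n]*nPk n zero = refl
[1+n]P[1+k]≡[1+n]*nPk n (suc k) with k <ᵇ n
... | true  = [1+n]P′[1+k]≡[1+n]*nP′k n (suc k)
... | false = sym (*-zeroʳ (suc n))

∣m-n∣<m+n : ∀ {m n} → 0 < m → 0 < n → ∣ m - n ∣ < m + n
∣m-n∣<m+n {m} {n} 0<m 0<n with ∣m-n∣≡[m∸n]∨[n∸m] m n
... | inj₁ eq rewrite eq = ≤-<-trans (m∸n≤m m n) (m<m+n m 0<n)
... | inj₂ eq rewrite eq = ≤-<-trans (m∸n≤m n m) (m<n+m n 0<m)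

m≤n⇒n≡m+∣m-n∣ : ∀ {m n} → m ≤ n → n ≡ m + ∣ m - n ∣
m≤n⇒n≡m+∣m-n∣ m≤n = trans (sym (m+[n∸m]≡n m≤n)) (cong (_ +_) (sym (m≤n⇒∣m-n∣≡n∸m m≤n)))

m+n≡o+p⇒∣m-o∣≡∣p-n∣ : ∀ {m n o p} → m + n ≡ o + p → ∣ m - o ∣ ≡ ∣ p - n ∣
m+n≡o+p⇒∣m-o∣≡∣p-n∣ {m} {n} {o} {p} eq = begin
  ∣ m - o ∣         ≡⟨ ∣m+n-m+o∣≡∣n-o∣ n m o ⟨
  ∣ n + m - n + o ∣ ≡⟨ cong₂ ∣_-_∣ (trans (+-comm n m) eq) (+-comm n o) ⟩
  ∣ o + p - o + n ∣ ≡⟨ ∣m+n-m+o∣≡∣n-o∣ o p n ⟩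
  ∣ p - n ∣         ∎
  where open ≡-Reasoning

∣o∸m-o∸n∣≡∣m-n∣ : ∀ {m n o} → m ≤ o → n ≤ o → ∣ o ∸ m - o ∸ n ∣ ≡ ∣ m - n ∣
∣o∸m-o∸n∣≡∣m-n∣ {m} {n} {o} m≤o n≤o = trans
  (m+n≡o+p⇒∣m-o∣≡∣p-n∣ {o ∸ m} {m} {o ∸ n} {n} (trans (m∸n+n≡m m≤o) (sym (m∸n+n≡m n≤o))))
  (∣-∣-comm n m)

-- The lower bound on ∣ q - q′ + m′ ∣ rules out q′ < q, leaving q′ = q + d.
ascents-separation : ∀ {q q′ d m m′} → 0 < m′ → ∣ q - q′ ∣ ≡ d → d + m′ ≤ ∣ q - q′ + m′ ∣ →
                     ∣ q + m - q′ + m′ ∣ ≡ ∣ m - d + m′ ∣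
ascents-separation {q} {q′} {d} {m} {m′} 0<m′ sep far with q ≤? q′
... | yes q≤q′ with t , refl ← m≤n⇒∃[o]m+o≡n q≤q′
               with refl ← trans (sym (∣m-m+n∣≡n q t)) sep =
  trans (cong (∣ q + m -_∣) (+-assoc q t m′)) (∣m+n-m+o∣≡∣n-o∣ q m (t + m′))
... | no q≰q′ with t , refl ← m≤n⇒∃[o]m+o≡n (<⇒≤ (≰⇒> q≰q′))
              with refl ← trans (sym (trans (∣-∣-comm (q′ + t) q′) (∣m-m+n∣≡n q′ t))) sep =
  contradiction far (<⇒≱ (subst (_< t + m′) (sym (∣m+n-m+o∣≡∣n-o∣ q′ t m′)) (∣m-n∣<m+n 0<t 0<m′)))
  where
  0<t : 0 < t
  0<t = +-cancelˡ-< q′ 0 t (subst (_< q′ + t) (sym (+-identityʳ q′)) (≰⇒> q≰q′))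

module _ {n : ℕ} {G : Graph n} where

  _++_ : ∀ {u v w l m} → Walk G u v l → Walk G v w m → Walk G u w (l + m)
  []      ++ q = q
  (e ∷ p) ++ q = e ∷ (p ++ q)

  _∷ʳ_ : ∀ {u v w l} → Walk G u v l → Adj G v w → Walk G u w (suc l)
  []       ∷ʳ e = e ∷ []
  (e′ ∷ p) ∷ʳ e = e′ ∷ (p ∷ʳ e)

  reverse : ∀ {u v l} → Walk G u v l → Walk G v u l
  reverse []      = []
  reverse (e ∷ p) = reverse p ∷ʳ Graph.sym G e

  walk-length-zero : ∀ {u v} → Walk G u v 0 → u ≡ v
  walk-length-zero [] = refl

  IsDist-sym : ∀ {u v d} → IsDist G u v d → IsDist G v u d
  IsDist-sym (w , minimal) = reverse w , minimal ∘ reverse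

  dist-triangle : ∀ {a x y s t l} → IsDist G a x s → IsDist G a y t → Walk G x y l → t ≤ s + l
  dist-triangle (w , _) (_ , minimal) p = minimal (w ++ p)

  predecessor : ∀ {a v D} → IsDist G a v (suc D) → ∃[ u ] IsDist G a u D × Adj G u v
  predecessor (w , minimal) with reverse w
  ... | e ∷ p = -, (reverse p , λ p′ → ≤-pred (minimal (p′ ∷ʳ Graph.sym G e))) , Graph.sym G e

  vertexAt : ∀ {u v l} → Walk G u v l → ℕ → Fin n
  vertexAt {u = u} _       zero    = u
  vertexAt {v = v} []      (suc j) = v
  vertexAt         (e ∷ p) (suc j) = vertexAt p j

  take : ∀ {u v l} (p : Walk G u v l) j → j ≤ l → Walk G u (vertexAt p j) j
  take p       zero    _         = []
  take (e ∷ p) (suc j) (s≤s j≤l) = e ∷ take p j j≤l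

  drop : ∀ {u v l} (p : Walk G u v l) j → Walk G (vertexAt p j) v (l ∸ j)
  drop p       zero    = p
  drop []      (suc j) = []
  drop (e ∷ p) (suc j) = drop p j

  segment : ∀ {u v l} (p : Walk G u v l) i d → i + d ≤ l →
            Walk G (vertexAt p i) (vertexAt p (i + d)) d
  segment p       zero    d i+d≤l       = take p d i+d≤l
  segment (e ∷ p) (suc i) d (s≤s i+d≤l) = segment p i d i+d≤l

  traversal-position : ∀ {u v l x y} {p : Walk G u v l} → Traverses G p x y →
                       ∃[ r ] suc r ≤ l × vertexAt p r ≡ x × vertexAt p (suc r) ≡ y
  traversal-position (this e p) = 0 , s≤s z≤n , refl , refl
  traversal-position (next e t) with r , r<l , at-r , at-1+r ← traversal-position t =
    suc r , s≤s r<l , at-r , at-1+r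

  segment-isDist : (S : ShortestPath G) → let open ShortestPath S in ∀ {i d} → i + d ≤ len →
                   IsDist G (vertexAt walk i) (vertexAt walk (i + d)) d
  segment-isDist S {i} {d} i+d≤len = segment walk i d i+d≤len , shortest
    where
    open ShortestPath S
    open ≤-Reasoning
    rest = len ∸ (i + d)
    shortest : ∀ {l} → Walk G (vertexAt walk i) (vertexAt walk (i + d)) l → d ≤ l
    shortest {l} w = +-cancelʳ-≤ rest d l (+-cancelˡ-≤ i _ _ (begin
      i + (d + rest) ≡⟨ +-assoc i d rest ⟨
      i + d + rest   ≡⟨ m+[n∸m]≡n i+d≤len ⟩
      len            ≤⟨ minimal (take walk i (m+n≤o⇒m≤o i i+d≤len) ++ (w ++ drop walk (i + d))) ⟩
      i + (l + rest) ∎))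

record Geodesic {n : ℕ} (G : Graph n) : Set where
  field
    len      : ℕ
    at       : ℕ → Fin n
    distance : ∀ {i j} → i ≤ len → j ≤ len → IsDist G (at i) (at j) ∣ i - j ∣
open Geodesic

module _ {n : ℕ} {G : Graph n} where

  geodesic : ShortestPath G → Geodesic G
  geodesic S = record { len = L ; at = vertexAt walk ; distance = distance′ }
    where
    open ShortestPath S using (walk) renaming (len to L)
    distance′ : ∀ {i j} → i ≤ L → j ≤ L → IsDist G (vertexAt walk i) (vertexAt walk j) ∣ i - j ∣
    distance′ {i} {j} i≤L j≤L with ≤-total i j
    ... | inj₁ i≤j with t , refl ← m≤n⇒∃[o]m+o≡n i≤j =
      subst (IsDist G _ _) (sym (∣m-m+n∣≡n i t)) (segment-isDist S j≤L)
    ... | inj₂ j≤i with t , refl ← m≤n⇒∃[o]m+o≡n j≤i =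
      subst (IsDist G _ _) (sym (trans (∣-∣-comm (j + t) j) (∣m-m+n∣≡n j t)))
            (IsDist-sym (segment-isDist S i≤L))

  OnGeodesic : Geodesic G → Fin n → Set
  OnGeodesic g v = ∃[ j ] j ≤ len g × at g j ≡ v

  edge-onGeodesic : ∀ (S : ShortestPath G) {u v} → EdgeOn G S u v →
                    OnGeodesic (geodesic S) u × OnGeodesic (geodesic S) v
  edge-onGeodesic _ (inj₁ t) with r , r<len , refl , refl ← traversal-position t =
    (r , <⇒≤ r<len , refl) , (suc r , r<len , refl)
  edge-onGeodesic _ (inj₂ t) with r , r<len , refl , refl ← traversal-position t =
    (suc r , r<len , refl) , (r , <⇒≤ r<len , refl)

  opposite : Geodesic G → Geodesic G
  opposite g = record
    { len      = len g
    ; at       = λ j → at g (len g ∸ j)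
    ; distance = λ {i} {j} i≤ j≤ → subst (IsDist G _ _) (∣o∸m-o∸n∣≡∣m-n∣ i≤ j≤)
                                     (distance g (m∸n≤m (len g) i) (m∸n≤m (len g) j))
    }

  orient : Bool → Geodesic G → Geodesic G
  orient true  g = g
  orient false g = opposite g

  module _ (g : Geodesic G) where

    walk-along : ∀ {q m} → q + m ≤ len g → Walk G (at g q) (at g (q + m)) m
    walk-along {q} {m} q+m≤len =
      subst (Walk G _ _) (∣m-m+n∣≡n q m) (proj₁ (distance g (m+n≤o⇒m≤o q q+m≤len) q+m≤len))

    onGeodesic-orient : ∀ b {v} → OnGeodesic (orient b g) v → OnGeodesic g v
    onGeodesic-orient true  on                 = on
    onGeodesic-orient false (j , j≤len , refl) = len g ∸ j , m∸n≤m (len g) j , refl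

    ascending-pair : ∀ {i j M} → i ≤ j → j ≤ len g → ∣ i - j ∣ ≡ M →
                     i + M ≤ len g × at g (i + M) ≡ at g j
    ascending-pair i≤j j≤len refl = subst (_≤ len g) j≡ j≤len , cong (at g) (sym j≡)
      where j≡ = m≤n⇒n≡m+∣m-n∣ i≤j

  orient-pair : (g : Geodesic G) → ∀ {i j M} → i ≤ len g → j ≤ len g → ∣ i - j ∣ ≡ M →
                ∃[ b ] ∃[ q ] q + M ≤ len (orient b g) × at (orient b g) q ≡ at g i
                              × at (orient b g) (q + M) ≡ at g j
  orient-pair g {i} {j} i≤len j≤len sep with i ≤? j
  ... | yes i≤j with q+M≤len , end ← ascending-pair g i≤j j≤len sep =
    true , i , q+M≤len , refl , end
  ... | no i≰j with q+M≤len , end ← ascending-pair (opposite g)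
                                      (∸-monoʳ-≤ (len g) (<⇒≤ (≰⇒> i≰j))) (m∸n≤m (len g) j)
                                      (trans (∣o∸m-o∸n∣≡∣m-n∣ i≤len j≤len) sep) =
    false , len g ∸ i , q+M≤len , cong (at g) (m∸[m∸n]≡n i≤len) ,
    trans end (cong (at g) (m∸[m∸n]≡n j≤len))

  module _ (g : Geodesic G) {a : Fin n} where

    separation≡rise : ∀ {i j s M} → i ≤ len g → j ≤ len g →
                      IsDist G a (at g i) s → IsDist G a (at g j) (s + M) →
                      Walk G (at g i) (at g j) M → ∣ i - j ∣ ≡ M
    separation≡rise {s = s} i≤len j≤len di dj w = ≤-antisym
      (proj₂ (distance g i≤len j≤len) w)
      (+-cancelˡ-≤ s _ _ (dist-triangle di dj (proj₁ (distance g i≤len j≤len))))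

    ascents-close : ∀ {q q′ m m′ s s′} → s ≤ s′ → 0 < m′ → q + m ≤ len g → q′ + m′ ≤ len g →
                    IsDist G a (at g q) s → IsDist G a (at g q′) s′ →
                    IsDist G a (at g (q′ + m′)) (s′ + m′) →
                    Walk G (at g q) (at g q′) ∣ s - s′ ∣ →
                    Walk G (at g (q + m)) (at g (q′ + m′)) ∣ s + m - s′ + m′ ∣
    ascents-close {q} {q′} {m} {m′} {s} s≤s′ 0<m′ q+m≤len q′+m′≤len dq dq′ dr′ w
      with d , refl ← m≤n⇒∃[o]m+o≡n s≤s′ =
      subst (Walk G _ _) rise (proj₁ (distance g q+m≤len q′+m′≤len))
      where
      q≤len = m+n≤o⇒m≤o q q+m≤len
      sep : ∣ q - q′ ∣ ≡ d
      sep = separation≡rise q≤len (m+n≤o⇒m≤o q′ q′+m′≤len) dq dq′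
                            (subst (Walk G _ _) (∣m-m+n∣≡n s d) w)
      far : d + m′ ≤ ∣ q - q′ + m′ ∣
      far = +-cancelˡ-≤ s _ _ (subst (_≤ s + ∣ q - q′ + m′ ∣) (+-assoc s d m′)
                                     (dist-triangle dq dr′ (proj₁ (distance g q≤len q′+m′≤len))))
      rise : ∣ q + m - q′ + m′ ∣ ≡ ∣ s + m - s + d + m′ ∣
      rise = trans (ascents-separation {q} {q′} {d} {m} 0<m′ sep far)
                   (sym (trans (cong (∣ s + m -_∣) (+-assoc s d m′)) (∣m+n-m+o∣≡∣n-o∣ s m (d + m′))))

module Routes {n : ℕ} (G : Graph n) (k : ℕ) (paths : Fin k → ShortestPath G) (a : Fin n) where

  open import Data.List.Membership.DecPropositional (_≟ᶠ_ {k}) using (_∈?_)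

  Code : Set
  Code = List (Fin k × Bool)

  indices : Code → List (Fin k)
  indices = List.map proj₁

  path : Fin k → Bool → Geodesic G
  path i b = orient b (geodesic (paths i))

  data Route : Fin n → ℕ → Code → Set where
    start : Route a 0 []
    climb : ∀ {x s c y q m} (i : Fin k) (b : Bool) → Route x s c → i ∉ indices c → 0 < m →
            q + m ≤ len (path i b) → at (path i b) q ≡ x → at (path i b) (q + m) ≡ y →
            IsDist G a y (s + m) → Route y (s + m) ((i , b) ∷ c)

  route-dist : ∀ {x s c} → Route x s c → IsDist G a x s
  route-dist start                      = [] , λ _ → z≤n
  route-dist (climb _ _ _ _ _ _ _ _ dy) = dy

  ascend : ∀ {x v s c M e} → Route x s c → (i : Fin k) → i ∉ indices c →
           OnGeodesic (geodesic (paths i)) x → OnGeodesic (geodesic (paths i)) v →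
           Walk G x v M → 0 < M → IsDist G a v e → e ≡ s + M → ∃[ b ] Route v e ((i , b) ∷ c)
  ascend R i i∉c (p , p≤len , refl) (p′ , p′≤len , refl) w 0<M dv refl
    with b , q , q+M≤len , start≡ , end≡ ←
           orient-pair (geodesic (paths i)) p≤len p′≤len
             (separation≡rise (geodesic (paths i)) p≤len p′≤len (route-dist R) dv w) =
    b , climb i b R i∉c 0<M q+M≤len start≡ end≡ dv

  reuse : ∀ {x v s c M e i} → Route x s c → i ∈ indices c → OnGeodesic (geodesic (paths i)) v →
          Walk G x v M → IsDist G a v e → e ≡ s + M → ∃[ c′ ] Route v e c′
  reuse (climb {s = s} {q = q} {m} j b R j∉c 0<m q+m≤len refl refl _) (here refl) onv w dv refl =
    -, proj₂ (ascend R j j∉c onx onv (walk-along (path j b) q+m≤len ++ w)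
                     (≤-trans 0<m (m≤m+n m _)) dv (+-assoc s m _))
    where onx = onGeodesic-orient (geodesic (paths j)) b (q , m+n≤o⇒m≤o q q+m≤len , refl)
  reuse (climb {s = s} {m = m} j b R _ _ q+m≤len refl refl _) (there i∈c) onv w dv refl =
    reuse R i∈c onv (walk-along (path j b) q+m≤len ++ w) dv (+-assoc s m _)

  extend : ∀ {x v s c M e} → Route x s c → (i : Fin k) →
           OnGeodesic (geodesic (paths i)) x → OnGeodesic (geodesic (paths i)) v →
           Walk G x v M → 0 < M → IsDist G a v e → e ≡ s + M → ∃[ c′ ] Route v e c′
  extend {c = c} R i onx onv w 0<M dv e≡ with i ∈? indices c
  ... | yes i∈c = reuse R i∈c onv w dv e≡
  ... | no  i∉c = -, proj₂ (ascend R i i∉c onx onv w 0<M dv e≡)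

  route : CoveredBy G k paths → ∀ {v D} → IsDist G a v D → ∃[ c ] Route v D c
  route cov {D = zero} (w , _) with refl ← walk-length-zero w = -, start
  route cov {v} {suc D} dv
    with u , du , u~v ← predecessor dv
    with i , on ← cov u v u~v
    with onu , onv ← edge-onGeodesic (paths i) on
    with c , R ← route cov du =
    extend R i onu onv (u~v ∷ []) (s≤s z≤n) dv (+-comm 1 D)

  routes-close : ∀ {x x′ s s′ c} → Route x s c → Route x′ s′ c → Walk G x x′ ∣ s - s′ ∣
  routes-close start start = []
  routes-close (climb {s = s}  {m = m}  i b R  _ 0<m  q+m≤len   refl refl dy)
               (climb {s = s′} {m = m′} _ _ R′ _ 0<m′ q′+m′≤len refl refl dy′)
    with ≤-total s s′
  ... | inj₁ s≤s′ =
    ascents-close (path i b) s≤s′ 0<m′ q+m≤len q′+m′≤len (route-dist R) (route-dist R′) dy′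
                  (routes-close R R′)
  ... | inj₂ s′≤s = subst (Walk G _ _) (∣-∣-comm (s′ + m′) (s + m)) (reverse
    (ascents-close (path i b) s′≤s 0<m q′+m′≤len q+m≤len (route-dist R′) (route-dist R) dy
                   (subst (Walk G _ _) (∣-∣-comm s s′) (reverse (routes-close R R′)))))

  route-unique : ∀ {x x′ D c} → Route x D c → Route x′ D c → x ≡ x′
  route-unique {D = D} R R′ =
    walk-length-zero (subst (Walk G _ _) (∣n-n∣≡0 D) (routes-close R R′))

  indices-unique : ∀ {x s c} → Route x s c → Unique (indices c)
  indices-unique start                       = []
  indices-unique (climb _ _ R i∉c _ _ _ _ _) = ¬Any⇒All¬ _ i∉c ∷ indices-unique R

  route-nonempty : ∀ {x s c} → Route x s c → 0 < s → 0 < length c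
  route-nonempty (climb _ _ _ _ _ _ _ _ _) _ = s≤s z≤n

module _ {B : Set} where

  ∈-─ : ∀ {x y} {ys : List B} (x∈ys : x ∈ ys) → y ∈ ys → y ≢ x → y ∈ (ys ─ x∈ys)
  ∈-─ (here refl)  (here refl)  y≢x = ⊥-elim (y≢x refl)
  ∈-─ (here refl)  (there y∈ys) _   = y∈ys
  ∈-─ (there x∈ys) (here refl)  _   = here refl
  ∈-─ (there x∈ys) (there y∈ys) y≢x = there (∈-─ x∈ys y∈ys y≢x)

module _ {A B : Set} where

  injection⇒length≤ : (R : A → B → Set) → (∀ {x y b} → R x b → R y b → x ≡ y) →
                      ∀ {xs ys} → Unique xs → All (λ x → ∃[ y ] R x y × y ∈ ys) xs →
                      length xs ≤ length ys
  injection⇒length≤ R R-injective [] [] = z≤n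
  injection⇒length≤ R R-injective {x ∷ xs} {ys} (x∉xs ∷ xs-unique) ((y , xRy , y∈ys) ∷ images) =
    subst (suc (length xs) ≤_) (sym (length-removeAt′ ys _))
          (s≤s (injection⇒length≤ R R-injective xs-unique (All.zipWith avoid (x∉xs , images))))
    where
    avoid : ∀ {x′} → x ≢ x′ × ∃[ y′ ] R x′ y′ × y′ ∈ ys → ∃[ y′ ] R x′ y′ × y′ ∈ (ys ─ y∈ys)
    avoid (x≢x′ , y′ , x′Ry′ , y′∈ys) =
      y′ , x′Ry′ , ∈-─ y∈ys y′∈ys λ { refl → x≢x′ (R-injective xRy x′Ry′) }

  length-concatMap : (f : A → List B) (xs : List A) →
                     length (List.concatMap f xs) ≡ sum (List.map (length ∘ f) xs)
  length-concatMap f []       = refl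
  length-concatMap f (x ∷ xs) =
    trans (length-++ (f x)) (cong (length (f x) +_) (length-concatMap f xs))

  length-concatMap-uniform : ∀ (f : A → List B) {c xs} → All (λ x → length (f x) ≡ c) xs →
                             length (List.concatMap f xs) ≡ length xs * c
  length-concatMap-uniform f []                     = refl
  length-concatMap-uniform f {xs = x ∷ _} (eq ∷ eqs) =
    trans (length-++ (f x)) (cong₂ _+_ eq (length-concatMap-uniform f eqs))

module _ {A : Set} where

  select : List A → List (A × List A)
  select []       = []
  select (x ∷ xs) = (x , xs) ∷ List.map (map₂ (x ∷_)) (select xs)

  length-select : ∀ xs → length (select xs) ≡ length xs
  length-select []       = refl
  length-select (x ∷ xs) = cong suc (trans (length-map _ (select xs)) (length-select xs))

  select-rest : ∀ xs → All (λ (_ , ys) → suc (length ys) ≡ length xs) (select xs)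
  select-rest []       = []
  select-rest (x ∷ xs) = refl ∷ map⁺ (All.map (cong suc) (select-rest xs))

  ∈-select : ∀ {x xs} → x ∈ xs → ∃[ ys ] (x , ys) ∈ select xs × (∀ {y} → y ∈ xs → y ≢ x → y ∈ ys)
  ∈-select {xs = _ ∷ xs} (here refl) =
    xs , here refl , λ { (here refl) y≢x → ⊥-elim (y≢x refl) ; (there y∈xs) _ → y∈xs }
  ∈-select {xs = z ∷ _} (there x∈xs) with ys , sel , keep ← ∈-select x∈xs =
    z ∷ ys , there (∈-map⁺ (map₂ (z ∷_)) sel) ,
    λ { (here refl) _ → here refl ; (there y∈xs) y≢x → there (keep y∈xs y≢x) }

  signings : A → List (List (A × Bool)) → List (List (A × Bool))
  signings x cs = List.map ((x , true) ∷_) cs List.++ List.map ((x , false) ∷_) cs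

  length-signings : ∀ x cs → length (signings x cs) ≡ length cs + length cs
  length-signings x cs =
    trans (length-++ (List.map ((x , true) ∷_) cs)) (cong₂ _+_ (length-map _ cs) (length-map _ cs))

  ∈-signings : ∀ {x c cs} b → c ∈ cs → ((x , b) ∷ c) ∈ signings x cs
  ∈-signings {x}          true  c∈cs = ∈-++⁺ˡ (∈-map⁺ ((x , true) ∷_) c∈cs)
  ∈-signings {x} {cs = cs} false c∈cs =
    ∈-++⁺ʳ (List.map ((x , true) ∷_) cs) (∈-map⁺ ((x , false) ∷_) c∈cs)

  signedArrangements : ℕ → List A → List (List (A × Bool))
  signedArrangements zero    xs = [ [] ]
  signedArrangements (suc l) xs =
    List.concatMap (λ (x , ys) → signings x (signedArrangements l ys)) (select xs)

  length-signedArrangements : ∀ l xs → length (signedArrangements l xs) ≡ 2 ^ l * (length xs P l)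
  length-signedArrangements zero    xs = refl
  length-signedArrangements (suc l) [] = sym (*-zeroʳ (2 ^ suc l))
  length-signedArrangements (suc l) xs@(_ ∷ ys) = begin
    length (signedArrangements (suc l) xs)
      ≡⟨ length-concatMap-uniform extensions (All.map each (select-rest xs)) ⟩
    length (select xs) * (u + u)
      ≡⟨ cong (_* (u + u)) (length-select xs) ⟩
    suc (length ys) * (u + u)
      ≡⟨ rearrange (suc (length ys)) (2 ^ l) (length ys P l) ⟩
    2 ^ suc l * (suc (length ys) * (length ys P l))
      ≡⟨ cong (2 ^ suc l *_) ([1+n]P[1+k]≡[1+n]*nPk (length ys) l) ⟨
    2 ^ suc l * (length xs P suc l) ∎
    where
    open ≡-Reasoning
    u = 2 ^ l * (length ys P l)
    rearrange : ∀ m p q → m * (p * q + p * q) ≡ 2 * p * (m * q)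
    rearrange = solve-∀
    extensions : A × List A → List (List (A × Bool))
    extensions (x , zs) = signings x (signedArrangements l zs)
    each : ∀ {p} → suc (length (proj₂ p)) ≡ length xs → length (extensions p) ≡ u + u
    each {x , zs} eq = trans (length-signings x (signedArrangements l zs)) (cong (λ c → c + c)
      (trans (length-signedArrangements l zs) (cong (λ m → 2 ^ l * (m P l)) (suc-injective eq))))

  ∈-signedArrangements : ∀ {xs} (c : List (A × Bool)) → Unique (List.map proj₁ c) →
                         (∀ {y} → y ∈ List.map proj₁ c → y ∈ xs) →
                         c ∈ signedArrangements (length c) xs
  ∈-signedArrangements []            _                  _   = here refl
  ∈-signedArrangements ((x , b) ∷ c) (x∉c ∷ c-unique) ⊆xs
    with ys , sel , keep ← ∈-select (⊆xs (here refl)) =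
    ∈-concat⁺′ (∈-signings b (∈-signedArrangements c c-unique ⊆ys)) (∈-map⁺ _ sel)
    where
    ⊆ys : ∀ {y} → y ∈ List.map proj₁ c → y ∈ ys
    ⊆ys y∈c = keep (⊆xs (there y∈c)) λ { refl → All.lookup x∉c y∈c refl }

codes : (k : ℕ) → List (List (Fin k × Bool))
codes k = List.concatMap (λ l → signedArrangements l (allFin k)) (applyUpTo suc k)

length-codes : ∀ k → length (codes k) ≡ h k
length-codes k = trans (length-concatMap (λ l → signedArrangements l (allFin k)) (applyUpTo suc k))
  (cong sum (map-cong (λ l → trans (length-signedArrangements l (allFin k))
                                   (cong (λ m → 2 ^ l * (m P l)) (length-tabulate {n = k} id)))
                      (applyUpTo suc k)))

∈-codes : ∀ {k} (c : List (Fin k × Bool)) → Unique (List.map proj₁ c) → 0 < length c →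
          c ∈ codes k
∈-codes {k} c@(_ ∷ c′) c-unique _ =
  ∈-concat⁺′ (∈-signedArrangements c c-unique λ {y} _ → ∈-allFin y)
             (∈-map⁺ (λ l → signedArrangements l (allFin k)) (∈-applyUpTo⁺ suc c′<k))
  where
  c′<k : length c′ < k
  c′<k = subst₂ _≤_ (length-map proj₁ c) (length-tabulate {n = k} id)
           (injection⇒length≤ _≡_ (λ { refl refl → refl }) c-unique
                              (All.tabulate λ {i} _ → i , refl , ∈-allFin i))

1≤h[1+k] : ∀ k → 1 ≤ h (suc k)
1≤h[1+k] k = s≤s z≤n

corollary9 : ∀ {n} (G : Graph n) → Connected G →
    (k : ℕ) → 1 ≤ k → (P : Fin k → ShortestPath G) → CoveredBy G k P →
    (a : Fin n) (D : ℕ) (vs : List (Fin n)) →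
    Unique vs → All (λ v → IsDist G a v D) vs →
    length vs ≤ h k
corollary9 G _ (suc k) _ paths cov a zero vs vs-unique vs-dist = ≤-trans
  (injection⇒length≤ _≡_ (λ { refl refl → refl }) {ys = [ a ]} vs-unique
     (All.map (λ d → a , sym (walk-length-zero (proj₁ d)) , here refl) vs-dist))
  (1≤h[1+k] k)
corollary9 G _ k _ paths cov a (suc D) vs vs-unique vs-dist = begin
  length vs
    ≤⟨ injection⇒length≤ (λ v c → Route v (suc D) c) route-unique vs-unique
                         (All.map coded vs-dist) ⟩
  length (codes k) ≡⟨ length-codes k ⟩
  h k              ∎
  where
  open Routes G k paths a
  open ≤-Reasoning
  coded : ∀ {v} → IsDist G a v (suc D) → ∃[ c ] Route v (suc D) c × c ∈ codes k
  coded d with c , R ← route cov d =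
    c , R , ∈-codes c (indices-unique R) (route-nonempty R (s≤s z≤n))
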